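{- Let $P$ be a polyomino, let $\min(P)$ be the minimum number of non-attacking rooks that dominate $P$, and let $\max(P)$ be the maximum number of non-attacking rooks that can be placed on $P$. Then $\min(P)\ge\lceil \max(P)/2\rceil$, and for every integer $k$ with $\min(P)\le k\le\max(P)$ there exists a dominating set of $k$ non-attacking rooks on $P$.
   Context: A polyomino is a finite union of unit squares (tiles) of the standard grid in $\mathbb{R}^2$ with connected interior. Two tiles of $P$ are in the same row (resp. column) of $P$ if the segment joining their centers is horizontal (resp. vertical) and contained in $P$. A rook on a tile guards that tile and every tile in the same row or column of $P$. A set of rooks dominates $P$ if every tile is guarded by some rook. A set of rooks on distinct tiles is non-attacking if no two are in the same row or column of $P$. -}

module Defs where

open import Data.Nat as ℕ using (ℕ)
open import Data.Integer as ℤ using (ℤ; ∣_∣; _-_; _≤_)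
open import Data.Product using (_×_; _,_; proj₁; proj₂; ∃; Σ)
open import Data.Sum using (_⊎_)
open import Data.List using (List; _∷_; []; length)
open import Data.List.Membership.Propositional using (_∈_)
open import Data.List.Relation.Unary.Unique.Propositional using (Unique)
open import Relation.Binary.PropositionalEquality using (_≡_; _≢_)
open import Relation.Nullary using (¬_)

-- A tile is identified by the integer coordinates (x , y) of its lower-left corner;
-- it is the unit square [x, x+1] × [y, y+1].
Tile : Set
Tile = ℤ × ℤ

Adjacent : Tile → Tile → Set
Adjacent (x , y) (x' , y') =
  (x ≡ x' × ∣ y - y' ∣ ≡ 1) ⊎ (y ≡ y' × ∣ x - x' ∣ ≡ 1)

data Path (T : List Tile) : Tile → Tile → Set where
  here : ∀ {a} → a ∈ T → Path T a a
  step : ∀ {a b c} → a ∈ T → Adjacent a b → Path T b c → Path T a c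

-- A polyomino: a finite nonempty set of tiles whose union has connected interior,
-- i.e. any two tiles are joined by a chain of edge-adjacent tiles.
record Polyomino : Set where
  field
    tiles     : List Tile
    distinct  : Unique tiles
    nonempty  : ∃ λ t → t ∈ tiles
    connected : ∀ {a b} → a ∈ tiles → b ∈ tiles → Path tiles a b
open Polyomino public

-- Two tiles are in the same row of P: the segment joining their centres is
-- horizontal and contained in P (i.e. every tile between them in that row is in P).
SameRow : Polyomino → Tile → Tile → Set
SameRow P a@(x , y) b@(x' , y') =
  a ∈ tiles P × b ∈ tiles P × y ≡ y' ×
  (∀ z → x ℤ.⊓ x' ≤ z → z ≤ x ℤ.⊔ x' → (z , y) ∈ tiles P)

-- Same column: the segment joining the centres is vertical and contained in P.
SameCol : Polyomino → Tile → Tile → Set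
SameCol P a@(x , y) b@(x' , y') =
  a ∈ tiles P × b ∈ tiles P × x ≡ x' ×
  (∀ z → y ℤ.⊓ y' ≤ z → z ≤ y ℤ.⊔ y' → (x , z) ∈ tiles P)

Guards : Polyomino → Tile → Tile → Set
Guards P r t = SameRow P r t ⊎ SameCol P r t

record Rooks (P : Polyomino) : Set where
  field
    squares  : List Tile
    onBoard  : ∀ {r} → r ∈ squares → r ∈ tiles P
    distinctR : Unique squares
open Rooks public

NonAttacking : (P : Polyomino) → Rooks P → Set
NonAttacking P R = ∀ {r s} → r ∈ squares R → s ∈ squares R → r ≢ s →
  ¬ SameRow P r s × ¬ SameCol P r s

Dominates : (P : Polyomino) → Rooks P → Set
Dominates P R = ∀ {t} → t ∈ tiles P → ∃ λ r → r ∈ squares R × Guards P r t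

IsMinP : Polyomino → ℕ → Set
IsMinP P m =
  (∃ λ (R : Rooks P) → NonAttacking P R × Dominates P R × length (squares R) ≡ m) ×
  (∀ (R : Rooks P) → NonAttacking P R → Dominates P R → m ℕ.≤ length (squares R))

IsMaxP : Polyomino → ℕ → Set
IsMaxP P M =
  (∃ λ (R : Rooks P) → NonAttacking P R × length (squares R) ≡ M) ×
  (∀ (R : Rooks P) → NonAttacking P R → length (squares R) ℕ.≤ M)

-- Rows and columns of a polyomino are equivalence classes, so a tile guards at
-- most one rook of a non-attacking set along its row and one along its column.
-- Hence a dominating set D and a non-attacking set B satisfy |B| ≤ 2|D|, which
-- gives ⌈max/2⌉ ≤ min.
--
-- For the interpolation, let X be non-attacking and dominating with |X| < |B|,
-- B non-attacking. Each row holds at most one rook of B and X meets at most |X|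
-- rows, so some b ∈ B shares no row with X; b is then guarded through the column
-- of some x ∈ X. Replacing x by b
-- keeps the set non-attacking and can only leave unguarded tiles in the row of x.
-- If there are none, X has been traded for a set sharing one more rook with B;
-- otherwise adding any such tile t gives a non-attacking dominating set of size
-- |X| + 1, because the row of t is the row of x. The first outcome can only
-- happen |X| times in a row.
module Submission where

open import Defs
open import Data.Nat as ℕ using (ℕ; zero; suc; ⌈_/2⌉; z≤n; s≤s)
import Data.Nat.Properties as ℕP
open import Data.Integer as ℤ using (ℤ; +_; +≤+; ∣_∣; _⊓_; _⊔_; _+_; _-_; -_; _≤_)
import Data.Integer.Properties as ℤP
open import Data.Integer.Tactic.RingSolver using (solve-∀)
open import Data.Product using (_×_; _,_; proj₁; proj₂; ∃; Σ)
open import Data.Product.Properties using (≡-dec)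
open import Data.Sum as Sum using (_⊎_; inj₁; inj₂; [_,_])
open import Data.Empty using (⊥-elim)
open import Function using (_∘_)
open import Data.List using (List; []; _∷_; length; filter)
open import Data.List.Properties using (filter-accept; filter-reject; length-filter; length-removeAt′)
open import Data.List.Relation.Unary.All as All using (All; _∷_)
open import Data.List.Relation.Unary.All.Properties using (all-filter; ¬Any⇒All¬)
open import Data.List.Relation.Unary.Any using (here; there; any?)
open import Data.List.Relation.Unary.AllPairs using (_∷_)
open import Data.List.Relation.Unary.Unique.Propositional using (Unique)
import Data.List.Relation.Unary.Unique.Propositional.Properties as Unique
open import Data.List.Membership.Propositional using (_∈_; _∉_; _─_; find; lose)
open import Data.List.Membership.Propositional.Properties using (∈-filter⁻)
import Data.List.Membership.DecPropositional as DecMembership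
open import Relation.Binary.Definitions using (Symmetric; Transitive; Decidable; DecidableEquality)
open import Relation.Binary.PropositionalEquality using (_≡_; _≢_; refl; sym; trans; cong; subst; subst₂; module ≡-Reasoning)
open import Relation.Nullary using (Dec; yes; no; ¬_; ¬?)
open import Relation.Nullary.Decidable using (map′; _×-dec_; _⊎-dec_)
import Relation.Unary as U

m≤2n⇒⌈m/2⌉≤n : ∀ {m n} → m ℕ.≤ 2 ℕ.* n → ⌈ m /2⌉ ℕ.≤ n
m≤2n⇒⌈m/2⌉≤n {m} {n} m≤2n = ℕP.≤-trans (ℕP.⌈n/2⌉-mono m≤2n) (ℕP.≤-reflexive ⌈2n/2⌉≡n)
  where
    ⌈2n/2⌉≡n : ⌈ 2 ℕ.* n /2⌉ ≡ n
    ⌈2n/2⌉≡n = trans (cong (λ k → ⌈ n ℕ.+ k /2⌉) (ℕP.+-identityʳ n)) (sym (ℕP.n≡⌈n+n/2⌉ n))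

-- SameRow and SameCol of Defs unfold to this shape, so the segment lemmas
-- below apply to them directly.
Segment : (ℤ → Set) → ℤ → ℤ → Set
Segment Q x y = ∀ z → x ⊓ y ≤ z → z ≤ x ⊔ y → Q z

⊓≤-cases : ∀ {x y z} → x ⊓ y ≤ z → x ≤ z ⊎ y ≤ z
⊓≤-cases {x} {y} {z} l = Sum.map (λ e → subst (_≤ z) e l) (λ e → subst (_≤ z) e l) (ℤP.⊓-sel x y)

≤⊔-cases : ∀ {x y z} → z ≤ x ⊔ y → z ≤ x ⊎ z ≤ y
≤⊔-cases {x} {y} {z} u = Sum.map (λ e → subst (z ≤_) e u) (λ e → subst (z ≤_) e u) (ℤP.⊔-sel x y)

i+[j-i]≡j : ∀ i j → i + (j - i) ≡ j
i+[j-i]≡j = solve-∀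

module _ {Q : ℤ → Set} where

  segment-within : ∀ {x y z} → Segment Q x y → x ≤ z ⊎ y ≤ z → z ≤ x ⊎ z ≤ y → Q z
  segment-within {x} {y} {z} s l u =
    s z ([ ℤP.i≤j⇒i⊓k≤j y , ℤP.i≤j⇒k⊓i≤j x ] l) ([ ℤP.i≤j⇒i≤j⊔k y , ℤP.i≤j⇒i≤k⊔j x ] u)

  segment-refl : ∀ {x} → Q x → Segment Q x x
  segment-refl q z l u =
    subst Q (ℤP.≤-antisym (Sum.reduce (⊓≤-cases l)) (Sum.reduce (≤⊔-cases u))) q

  segment-sym : ∀ {x y} → Segment Q x y → Segment Q y x
  segment-sym s z l u = segment-within s (Sum.swap (⊓≤-cases l)) (Sum.swap (≤⊔-cases u))

  segment-trans : ∀ {x y w} → Segment Q x y → Segment Q y w → Segment Q x w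
  segment-trans {y = y} s t z l u with ℤP.≤-total z y | ⊓≤-cases l | ≤⊔-cases u
  ... | inj₁ z≤y | inj₁ x≤z | _      = segment-within s (inj₁ x≤z) (inj₂ z≤y)
  ... | inj₁ z≤y | inj₂ w≤z | _      = segment-within t (inj₂ w≤z) (inj₁ z≤y)
  ... | inj₂ y≤z | _      | inj₁ z≤x = segment-within s (inj₂ y≤z) (inj₁ z≤x)
  ... | inj₂ y≤z | _      | inj₂ z≤w = segment-within t (inj₁ y≤z) (inj₂ z≤w)

  segment? : U.Decidable Q → ∀ x y → Dec (Segment Q x y)
  segment? Q? x y = map′ fromOffsets toOffsets (ℕP.allUpTo? (λ n → Q? (lo + + n)) (suc width))
    where
      lo hi : ℤ
      lo = x ⊓ y
      hi = x ⊔ y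
      width : ℕ
      width = ∣ hi - lo ∣

      +∣j-i∣≡j-i : ∀ {i j} → i ≤ j → + ∣ j - i ∣ ≡ j - i
      +∣j-i∣≡j-i = ℤP.0≤i⇒+∣i∣≡i ∘ ℤP.i≤j⇒0≤j-i

      fromOffsets : (∀ {n} → n ℕ.< suc width → Q (lo + + n)) → Segment Q x y
      fromOffsets q z lo≤z z≤hi = subst Q lo+offset≡z (q (s≤s offset≤width))
        where
          offset : ℕ
          offset = ∣ z - lo ∣
          lo+offset≡z : lo + + offset ≡ z
          lo+offset≡z = trans (cong (λ i → lo + i) (+∣j-i∣≡j-i lo≤z)) (i+[j-i]≡j lo z)
          offset≤width : offset ℕ.≤ width
          offset≤width = ℤP.drop‿+≤+ (subst₂ _≤_ (sym (+∣j-i∣≡j-i lo≤z))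
            (sym (+∣j-i∣≡j-i (ℤP.≤-trans lo≤z z≤hi))) (ℤP.+-monoˡ-≤ (- lo) z≤hi))

      toOffsets : Segment Q x y → ∀ {n} → n ℕ.< suc width → Q (lo + + n)
      toOffsets s {n} (s≤s n≤width) = s (lo + + n) (ℤP.i≤i+j lo (+ n)) (ℤP.≤-trans
        (ℤP.+-monoʳ-≤ lo (+≤+ n≤width))
        (ℤP.≤-reflexive (trans (cong (λ i → lo + i) (+∣j-i∣≡j-i (ℤP.i⊓j≤i⊔j x y))) (i+[j-i]≡j lo hi))))

module _ {A : Set} where

  ∈-─⁻ : ∀ {x y : A} {xs} (p : x ∈ xs) → y ∈ xs ─ p → y ∈ xs
  ∈-─⁻ (here refl) y∈ = there y∈
  ∈-─⁻ (there p) (here y≡) = here y≡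
  ∈-─⁻ (there p) (there y∈) = there (∈-─⁻ p y∈)

  ∈-─⁺ : ∀ {x y : A} {xs} (p : x ∈ xs) → y ∈ xs → y ≢ x → y ∈ xs ─ p
  ∈-─⁺ (here refl) (here refl) y≢x = ⊥-elim (y≢x refl)
  ∈-─⁺ (here refl) (there y∈) _ = y∈
  ∈-─⁺ (there p) (here y≡) _ = here y≡
  ∈-─⁺ (there p) (there y∈) y≢x = there (∈-─⁺ p y∈ y≢x)

  ∉-─ : ∀ {x : A} {xs} (p : x ∈ xs) → Unique xs → x ∉ xs ─ p
  ∉-─ (here refl) (x≢xs ∷ _) x∈ = All.lookup x≢xs x∈ refl
  ∉-─ (there p) (y≢xs ∷ _) (here refl) = All.lookup y≢xs p refl
  ∉-─ (there p) (_ ∷ u) (there x∈) = ∉-─ p u x∈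

  Unique-─ : ∀ {x : A} {xs} (p : x ∈ xs) → Unique xs → Unique (xs ─ p)
  Unique-─ (here _) (_ ∷ u) = u
  Unique-─ (there p) (y≢xs ∷ u) = All.tabulate (All.lookup y≢xs ∘ ∈-─⁻ p) ∷ Unique-─ p u

  filter-─ : ∀ {P : A → Set} (P? : U.Decidable P) {x xs} (p : x ∈ xs) →
    ¬ P x → filter P? (xs ─ p) ≡ filter P? xs
  filter-─ P? (here refl) ¬Px = sym (filter-reject P? ¬Px)
  filter-─ P? (there {x = y} p) ¬Px with P? y
  ... | yes _ = cong (y ∷_) (filter-─ P? p ¬Px)
  ... | no _ = filter-─ P? p ¬Px

  length-filter-split : ∀ {P : A → Set} (P? : U.Decidable P) xs →
    length xs ≡ length (filter P? xs) ℕ.+ length (filter (¬? ∘ P?) xs)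
  length-filter-split P? [] = refl
  length-filter-split P? (x ∷ xs) with P? x
  ... | yes _ = cong suc (length-filter-split P? xs)
  ... | no _ = trans (cong suc (length-filter-split P? xs)) (sym (ℕP.+-suc _ _))

  Unique-∷ : ∀ {x : A} {xs} → x ∉ xs → Unique xs → Unique (x ∷ xs)
  Unique-∷ {xs = xs} x∉xs u = ¬Any⇒All¬ xs x∉xs ∷ u

module _ {A : Set} {Q : A → A → Set} where

  covered⊎uncovered : Decidable Q → ∀ (S L : List A) →
    (∀ {t} → t ∈ L → ∃ λ r → r ∈ S × Q r t) ⊎ (∃ λ t → t ∈ L × ∀ {r} → r ∈ S → ¬ Q r t)
  covered⊎uncovered Q? S L with any? (λ t → ¬? (any? (λ r → Q? r t) S)) L
  ... | yes uncovered = let t , t∈L , ¬Q = find uncovered in inj₂ (t , t∈L , λ r∈S → ¬Q ∘ lose r∈S)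
  ... | no ¬uncovered = inj₁ covered
    where
      covered : ∀ {t} → t ∈ L → ∃ λ r → r ∈ S × Q r t
      covered {t} t∈L with any? (λ r → Q? r t) S
      ... | yes Q-some = find Q-some
      ... | no Q-none = ⊥-elim (¬uncovered (lose t∈L Q-none))

  class-meets-≤1 : Symmetric Q → Transitive Q → ∀ {d xs} → Unique xs →
    (∀ {r s} → r ∈ xs → s ∈ xs → r ≢ s → ¬ Q r s) → All (Q d) xs → length xs ℕ.≤ 1
  class-meets-≤1 sym trans {xs = []} _ _ _ = z≤n
  class-meets-≤1 sym trans {xs = _ ∷ []} _ _ _ = s≤s z≤n
  class-meets-≤1 sym trans {xs = _ ∷ _ ∷ _} ((r≢s ∷ _) ∷ _) unrelated (dQr ∷ dQs ∷ _) =
    ⊥-elim (unrelated (here refl) (there (here refl)) r≢s (trans (sym dQr) dQs))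

_≟ᵀ_ : DecidableEquality Tile
_≟ᵀ_ = ≡-dec ℤ._≟_ ℤ._≟_

open DecMembership _≟ᵀ_ using (_∈?_)

module Guarding (P : Polyomino) where

  T : List Tile
  T = tiles P

  Row Col : Tile → Tile → Set
  Row = SameRow P
  Col = SameCol P

  row-refl : ∀ {a} → a ∈ T → Row a a
  row-refl a∈T = a∈T , a∈T , refl , segment-refl a∈T

  row-sym : Symmetric Row
  row-sym {_ , _} {_ , _} (a∈T , b∈T , refl , s) = b∈T , a∈T , refl , segment-sym s

  col-sym : Symmetric Col
  col-sym {_ , _} {_ , _} (a∈T , b∈T , refl , s) = b∈T , a∈T , refl , segment-sym s

  row-trans : Transitive Row
  row-trans {_ , _} {_ , _} {_ , _} (a∈T , _ , refl , s) (_ , c∈T , refl , t) =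
    a∈T , c∈T , refl , segment-trans s t

  col-trans : Transitive Col
  col-trans {_ , _} {_ , _} {_ , _} (a∈T , _ , refl , s) (_ , c∈T , refl , t) =
    a∈T , c∈T , refl , segment-trans s t

  row? : Decidable Row
  row? a@(x , y) b@(x' , y') =
    a ∈? T ×-dec b ∈? T ×-dec y ℤ.≟ y' ×-dec segment? (λ z → (z , y) ∈? T) x x'

  col? : Decidable Col
  col? a@(x , y) b@(x' , y') =
    a ∈? T ×-dec b ∈? T ×-dec x ℤ.≟ x' ×-dec segment? (λ z → (x , z) ∈? T) y y'

  guards? : Decidable (Guards P)
  guards? a b = row? a b ⊎-dec col? a b

  Independent : List Tile → Set
  Independent S = ∀ {r s} → r ∈ S → s ∈ S → r ≢ s → ¬ Row r s × ¬ Col r s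

  Dominating : List Tile → Set
  Dominating S = ∀ {t} → t ∈ T → ∃ λ r → r ∈ S × Guards P r t

  IndependentDominating : ℕ → Set
  IndependentDominating k =
    ∃ λ (R : Rooks P) → NonAttacking P R × Dominates P R × length (squares R) ≡ k

  Independent-filter : ∀ {Q : Tile → Set} (Q? : U.Decidable Q) {S} →
    Independent S → Independent (filter Q? S)
  Independent-filter Q? ind r∈ s∈ = ind (proj₁ (∈-filter⁻ Q? r∈)) (proj₁ (∈-filter⁻ Q? s∈))

  Independent-∷ : ∀ {t S} → Independent S → (∀ {r} → r ∈ S → ¬ Row r t × ¬ Col r t) →
    Independent (t ∷ S)
  Independent-∷ ind apart (here refl) (here refl) t≢t = ⊥-elim (t≢t refl)
  Independent-∷ ind apart (here refl) (there s∈) _ =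
    proj₁ (apart s∈) ∘ row-sym , proj₂ (apart s∈) ∘ col-sym
  Independent-∷ ind apart (there r∈) (here refl) _ = apart r∈
  Independent-∷ ind apart (there r∈) (there s∈) r≢s = ind r∈ s∈ r≢s

  row-meets-≤1 : ∀ {d S} → Unique S → Independent S → All (Row d) S → length S ℕ.≤ 1
  row-meets-≤1 u ind = class-meets-≤1 row-sym row-trans u (λ r∈ s∈ → proj₁ ∘ ind r∈ s∈)

  col-meets-≤1 : ∀ {d S} → Unique S → Independent S → All (Col d) S → length S ℕ.≤ 1
  col-meets-≤1 u ind = class-meets-≤1 col-sym col-trans u (λ r∈ s∈ → proj₂ ∘ ind r∈ s∈)

  guards-≤2 : ∀ {d S} → Unique S → Independent S → All (Guards P d) S → length S ℕ.≤ 2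
  guards-≤2 {d} {S} u ind guarded = begin
    length S                                     ≡⟨ length-filter-split (row? d) S ⟩
    length (filter (row? d) S) ℕ.+ length others ≤⟨ ℕP.+-mono-≤ rows≤1 others≤1 ⟩
    2                                            ∎
    where
      open ℕP.≤-Reasoning
      others : List Tile
      others = filter (¬? ∘ row? d) S
      rows≤1 : length (filter (row? d) S) ℕ.≤ 1
      rows≤1 = row-meets-≤1 (Unique.filter⁺ (row? d) u) (Independent-filter (row? d) ind)
        (all-filter (row? d) S)
      others-in-col : All (Col d) others
      others-in-col = All.tabulate λ r∈ → let r∈S , ¬row = ∈-filter⁻ (¬? ∘ row? d) r∈ in
        [ ⊥-elim ∘ ¬row , (λ col → col) ] (All.lookup guarded r∈S)
      others≤1 : length others ℕ.≤ 1
      others≤1 = col-meets-≤1 (Unique.filter⁺ (¬? ∘ row? d) u)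
        (Independent-filter (¬? ∘ row? d) ind) others-in-col

  module _ {Q : Tile → Tile → Set} (Q? : Decidable Q) {c : ℕ}
           (meets-≤c : ∀ {d S} → Unique S → Independent S → All (Q d) S → length S ℕ.≤ c) where

    covered-length≤ : ∀ D {B} → Unique B → Independent B →
      (∀ {b} → b ∈ B → ∃ λ d → d ∈ D × Q d b) → length B ℕ.≤ c ℕ.* length D
    covered-length≤ [] {[]} _ _ _ = z≤n
    covered-length≤ [] {_ ∷ _} _ _ covered with covered (here refl)
    ... | _ , () , _
    covered-length≤ (d ∷ D) {B} u ind covered = begin
      length B                                     ≡⟨ length-filter-split (Q? d) B ⟩
      length (filter (Q? d) B) ℕ.+ length others   ≤⟨ ℕP.+-mono-≤ near≤c others≤ ⟩
      c ℕ.+ c ℕ.* length D                         ≡⟨ ℕP.*-suc c (length D) ⟨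
      c ℕ.* length (d ∷ D)                         ∎
      where
        open ℕP.≤-Reasoning
        others : List Tile
        others = filter (¬? ∘ Q? d) B
        near≤c : length (filter (Q? d) B) ℕ.≤ c
        near≤c = meets-≤c (Unique.filter⁺ (Q? d) u) (Independent-filter (Q? d) ind)
          (all-filter (Q? d) B)
        others-covered : ∀ {b} → b ∈ others → ∃ λ d' → d' ∈ D × Q d' b
        others-covered b∈ with ∈-filter⁻ (¬? ∘ Q? d) b∈
        ... | b∈B , ¬Qdb with covered b∈B
        ...   | _ , here refl , Qdb = ⊥-elim (¬Qdb Qdb)
        ...   | d' , there d'∈D , Qd'b = d' , d'∈D , Qd'b
        others≤ : length others ℕ.≤ c ℕ.* length D
        others≤ = covered-length≤ D (Unique.filter⁺ (¬? ∘ Q? d) u)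
          (Independent-filter (¬? ∘ Q? d) ind) others-covered

  nonAttacking≤2*dominating : (B D : Rooks P) → NonAttacking P B → Dominates P D →
    length (squares B) ℕ.≤ 2 ℕ.* length (squares D)
  nonAttacking≤2*dominating B D B-na D-dom =
    covered-length≤ guards? guards-≤2 (squares D) (distinctR B) B-na (D-dom ∘ onBoard B)

  ∃-off-rows : ∀ X {B} → Unique B → Independent B → length X ℕ.< length B →
    ∃ λ b → b ∈ B × ∀ {x} → x ∈ X → ¬ Row x b
  ∃-off-rows X {B} u ind X<B with covered⊎uncovered row? X B
  ... | inj₂ off-rows = off-rows
  ... | inj₁ covered = ⊥-elim (ℕP.<⇒≱ X<B
    (subst (length B ℕ.≤_) (ℕP.*-identityˡ _) (covered-length≤ row? row-meets-≤1 X u ind covered)))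

  module Exchange (B : Rooks P) (B-na : NonAttacking P B) where

    shared : List Tile → ℕ
    shared S = length (filter (_∈? squares B) S)

    sharedWith : ∀ {k} → IndependentDominating k → ℕ
    sharedWith (X , _) = shared (squares X)

    module Swap {k} (X : Rooks P) (X-na : NonAttacking P X) (X-dom : Dominates P X)
                (X-len : length (squares X) ≡ k) {b x} (b∈B : b ∈ squares B)
                (b-off-rows : ∀ {r} → r ∈ squares X → ¬ Row r b)
                (x∈X : x ∈ squares X) (x-col-b : Col x b) where

      X₀ X₁ : List Tile
      X₀ = squares X ─ x∈X
      X₁ = b ∷ X₀

      b∉X : b ∉ squares X
      b∉X b∈X = b-off-rows b∈X (row-refl (onBoard B b∈B))

      x∉B : x ∉ squares B
      x∉B x∈B with x ≟ᵀ b
      ... | yes refl = b∉X x∈X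
      ... | no x≢b = proj₂ (B-na x∈B b∈B x≢b) x-col-b

      X₀⊆X : ∀ {r} → r ∈ X₀ → r ∈ squares X
      X₀⊆X = ∈-─⁻ x∈X

      X₀∌x : ∀ {r} → r ∈ X₀ → r ≢ x
      X₀∌x r∈X₀ refl = ∉-─ x∈X (distinctR X) r∈X₀

      X₁⊆T : ∀ {r} → r ∈ X₁ → r ∈ T
      X₁⊆T (here refl) = onBoard B b∈B
      X₁⊆T (there r∈X₀) = onBoard X (X₀⊆X r∈X₀)

      X₁-unique : Unique X₁
      X₁-unique = Unique-∷ (b∉X ∘ X₀⊆X) (Unique-─ x∈X (distinctR X))

      X₁-independent : Independent X₁
      X₁-independent = Independent-∷ (λ r∈ s∈ → X-na (X₀⊆X r∈) (X₀⊆X s∈)) λ r∈X₀ →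
        b-off-rows (X₀⊆X r∈X₀) ,
        λ r-col-b → proj₂ (X-na x∈X (X₀⊆X r∈X₀) (X₀∌x r∈X₀ ∘ sym)) (col-trans x-col-b (col-sym r-col-b))

      X₁-length : length X₁ ≡ k
      X₁-length = trans (sym (length-removeAt′ (squares X) _)) X-len

      X₁-shared : shared X₁ ≡ suc (shared (squares X))
      X₁-shared = begin
        shared (b ∷ X₀)             ≡⟨ cong length (filter-accept (_∈? squares B) b∈B) ⟩
        suc (shared X₀)             ≡⟨ cong (suc ∘ length) (filter-─ (_∈? squares B) x∈X x∉B) ⟩
        suc (shared (squares X))    ∎
        where open ≡-Reasoning

      -- Only x was removed, and its column is guarded by b.
      guarded⊎in-row-of-x : ∀ {t} → t ∈ T → (∃ λ r → r ∈ X₁ × Guards P r t) ⊎ Row x t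
      guarded⊎in-row-of-x t∈T with X-dom t∈T
      ... | r , r∈X , r-guards-t with r ≟ᵀ x
      ...   | no r≢x = inj₁ (r , there (∈-─⁺ x∈X r∈X r≢x) , r-guards-t)
      ...   | yes refl with r-guards-t
      ...     | inj₁ x-row-t = inj₂ x-row-t
      ...     | inj₂ x-col-t = inj₁ (b , here refl , inj₂ (col-trans (col-sym x-col-b) x-col-t))

      swapped : Rooks P
      swapped = record { squares = X₁ ; onBoard = X₁⊆T ; distinctR = X₁-unique }

      extended : ∀ {t} → t ∈ T → (∀ {r} → r ∈ X₁ → ¬ Guards P r t) → IndependentDominating (suc k)
      extended {t} t∈T unguarded =
        record { squares = t ∷ X₁ ; onBoard = onBoard′ ; distinctR = Unique-∷ t∉X₁ X₁-unique } ,
        Independent-∷ X₁-independent (λ r∈X₁ → unguarded r∈X₁ ∘ inj₁ , unguarded r∈X₁ ∘ inj₂) ,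
        dominating ,
        cong suc X₁-length
        where
          t∉X₁ : t ∉ X₁
          t∉X₁ t∈X₁ = unguarded t∈X₁ (inj₁ (row-refl t∈T))
          onBoard′ : ∀ {r} → r ∈ t ∷ X₁ → r ∈ T
          onBoard′ (here refl) = t∈T
          onBoard′ (there r∈X₁) = X₁⊆T r∈X₁
          x-row-t : Row x t
          x-row-t with guarded⊎in-row-of-x t∈T
          ... | inj₁ (_ , r∈X₁ , r-guards-t) = ⊥-elim (unguarded r∈X₁ r-guards-t)
          ... | inj₂ x-row-t = x-row-t
          dominating : Dominating (t ∷ X₁)
          dominating s∈T with guarded⊎in-row-of-x s∈T
          ... | inj₁ (r , r∈X₁ , r-guards-s) = r , there r∈X₁ , r-guards-s
          ... | inj₂ x-row-s = t , here refl , inj₁ (row-trans (row-sym x-row-t) x-row-s)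

      outcome : IndependentDominating (suc k) ⊎
        Σ (IndependentDominating k) (λ X′ → sharedWith X′ ≡ suc (shared (squares X)))
      outcome with covered⊎uncovered guards? X₁ T
      ... | inj₁ dominating = inj₂ ((swapped , X₁-independent , dominating , X₁-length) , X₁-shared)
      ... | inj₂ (t , t∈T , unguarded) = inj₁ (extended t∈T unguarded)

    exchange : ∀ {k} (X : IndependentDominating k) → k ℕ.< length (squares B) →
      IndependentDominating (suc k) ⊎
      Σ (IndependentDominating k) (λ X′ → sharedWith X′ ≡ suc (sharedWith X))
    exchange (X , X-na , X-dom , X-len) k<B
      with ∃-off-rows (squares X) (distinctR B) B-na (subst (ℕ._< _) (sym X-len) k<B)
    ... | b , b∈B , b-off-rows with X-dom (onBoard B b∈B)
    ...   | x , x∈X , inj₁ x-row-b = ⊥-elim (b-off-rows x∈X x-row-b)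
    ...   | x , x∈X , inj₂ x-col-b = Swap.outcome X X-na X-dom X-len b∈B b-off-rows x∈X x-col-b

    grow : ∀ {k} → IndependentDominating k → k ℕ.< length (squares B) → IndependentDominating (suc k)
    grow {k} X k<B = iterate k X (ℕP.m≤m+n k _)
      where
        iterate : ∀ n (X : IndependentDominating k) → k ℕ.≤ n ℕ.+ sharedWith X → IndependentDominating (suc k)
        iterate n X k≤n+shared with exchange X k<B
        ... | inj₁ X⁺ = X⁺
        iterate zero X k≤shared | inj₂ ((X′ , _ , _ , X′-len) , more) =
          ⊥-elim (ℕP.<-irrefl refl (ℕP.≤-trans (subst (ℕ._≤ k) more shared≤k) k≤shared))
          where
            shared≤k : shared (squares X′) ℕ.≤ k
            shared≤k = subst (_ ℕ.≤_) X′-len (length-filter (_∈? squares B) (squares X′))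
        iterate (suc n) X k≤ | inj₂ (X′ , more) =
          iterate n X′ (subst (k ℕ.≤_) (trans (sym (ℕP.+-suc n _)) (cong (n ℕ.+_) (sym more))) k≤)

    interpolate : ∀ {m} → IndependentDominating m →
      ∀ k → m ℕ.≤ k → k ℕ.≤ length (squares B) → IndependentDominating k
    interpolate X zero z≤n _ = X
    interpolate X (suc k) m≤1+k 1+k≤B with ℕP.m≤n⇒m<n∨m≡n m≤1+k
    ... | inj₁ (s≤s m≤k) = grow (interpolate X k m≤k (ℕP.<⇒≤ 1+k≤B)) 1+k≤B
    ... | inj₂ refl = X

theorem15 : (P : Polyomino) (m M : ℕ) → IsMinP P m → IsMaxP P M →
    (⌈ M /2⌉ ℕ.≤ m) ×
    (∀ k → m ℕ.≤ k → k ℕ.≤ M →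
      ∃ λ (R : Rooks P) → NonAttacking P R × Dominates P R × length (squares R) ≡ k)
theorem15 P m M (min@(D , _ , D-dom , D-len) , _) ((B , B-na , B-len) , _) =
  m≤2n⇒⌈m/2⌉≤n M≤2m ,
  λ k m≤k k≤M → interpolate min k m≤k (subst (k ℕ.≤_) (sym B-len) k≤M)
  where
    open Guarding P
    open Exchange B B-na
    M≤2m : M ℕ.≤ 2 ℕ.* m
    M≤2m = subst₂ (λ M m → M ℕ.≤ 2 ℕ.* m) B-len D-len (nonAttacking≤2*dominating B D B-na D-dom)
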